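{- Let $n\ge2$, $d\ge1$ and let $f:E_n^d\to\{0,1\}$ be a function such that $1\le|\textup{Vert}(P(f))|\le 2$ and $P(f)\cap M_0(f)=\emptyset$. Then $f\in\mathfrak{T}(d,n,k)$ for every $k\ge2$.
   Context: $E_n^d=\{0,1,\dots,n-1\}^d$, $M_\nu(f)=\{x\in E_n^d: f(x)=\nu\}$, $P(f)=\textup{Conv}(M_1(f))\subseteq\mathbb{R}^d$ and $\textup{Vert}(P)$ is the vertex set of a polytope $P$. $\mathfrak{T}(d,n,k)$ is the class of functions $f:E_n^d\to\{0,1\}$ for which there are real numbers $a_{ij}$ with $M_1(f)=\{x\in E_n^d: \sum_{j=1}^d a_{ij}x_j\le a_{i0},\ i=1,\dots,k\}$.
   Formalization: The polytope $P(f)$ and its vertices are formed in ℚ^d rather than $\mathbb{R}^d$, and the coefficients $a_{ij}$ are taken in ℚ. -}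

module Defs where

open import Data.Nat using (ℕ; zero; suc)
open import Data.Fin using (Fin; zero; suc; toℕ)
open import Data.Integer using (+_)
open import Data.Rational using (ℚ; 0ℚ; 1ℚ; _+_; _*_; _-_; _≤_; _<_; _/_)
open import Data.Product using (Σ; _×_; ∃)
open import Data.Sum using (_⊎_)
open import Relation.Binary.PropositionalEquality using (_≡_)
open import Relation.Nullary using (¬_)
open import Function.Bundles using (_⇔_)

E : ℕ → ℕ → Set
E n d = Fin d → Fin n

BoolFun : ℕ → ℕ → Set
BoolFun n d = E n d → Fin 2

M : ∀ {n d} → Fin 2 → BoolFun n d → E n d → Set
M ν f x = f x ≡ ν

-- points of ℚ^d (ℚ is used in place of ℝ)
Vecℚ : ℕ → Set
Vecℚ d = Fin d → ℚ

emb : ∀ {n d} → E n d → Vecℚ d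
emb x j = (+ toℕ (x j)) / 1

sumFin : (m : ℕ) → (Fin m → ℚ) → ℚ
sumFin zero    g = 0ℚ
sumFin (suc m) g = g zero + sumFin m (λ i → g (suc i))

InP : ∀ {n d} → BoolFun n d → Vecℚ d → Set
InP {n} {d} f y =
  Σ ℕ λ m → Σ (Fin m → E n d) λ p → Σ (Fin m → ℚ) λ w →
    (∀ i → M (suc zero) f (p i)) ×
    (∀ i → 0ℚ ≤ w i) ×
    (sumFin m w ≡ 1ℚ) ×
    (∀ j → y j ≡ sumFin m (λ i → w i * emb (p i) j))

_≈ᵥ_ : ∀ {d} → Vecℚ d → Vecℚ d → Set
u ≈ᵥ v = ∀ j → u j ≡ v j

IsVertex : ∀ {n d} → BoolFun n d → Vecℚ d → Set
IsVertex {n} {d} f y =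
  InP f y ×
  (∀ (a b : Vecℚ d) (t : ℚ) → InP f a → InP f b → 0ℚ < t → t < 1ℚ →
     (∀ j → y j ≡ (1ℚ - t) * a j + t * b j) → a ≈ᵥ b)

OneOrTwoVertices : ∀ {n d} → BoolFun n d → Set
OneOrTwoVertices {n} {d} f =
  (∃ λ v → IsVertex f v) ×
  (∀ u v w → IsVertex f u → IsVertex f v → IsVertex f w →
     (u ≈ᵥ v) ⊎ ((u ≈ᵥ w) ⊎ (v ≈ᵥ w)))

DisjointP-M0 : ∀ {n d} → BoolFun n d → Set
DisjointP-M0 {n} {d} f = ∀ (x : E n d) → M zero f x → ¬ InP f (emb x)

InT : (d n k : ℕ) → BoolFun n d → Set
InT d n k f =
  Σ (Fin k → Fin (suc d) → ℚ) λ a →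
    ∀ (x : E n d) →
      M (suc zero) f x ⇔ (∀ i → sumFin d (λ j → a i (suc j) * emb x j) ≤ a i zero)

-- Since P(f) misses M₀(f), M₁(f) is exactly the set of grid points of P(f).
-- Minimising an integer linear form over M₁(f), with ties broken by the form
-- Σ nʲ xⱼ (injective on the grid), picks out a vertex of P(f); hence every
-- linear form attains its minimum over M₁(f) at one of the at most two
-- vertices. With one vertex M₁(f) is a point. With two vertices u, v and
-- uᵢ < vᵢ, the forms (vᵢ - uᵢ) xⱼ - (vⱼ - uⱼ) xᵢ and ±xᵢ show that M₁(f) is the
-- set of grid points of the segment [u, v]. The collinearity defects are
-- small integers, so they pack into one integer Δ written in a large base,
-- and the segment's grid points are cut out by the two inequalities
-- uᵢ ≤ n Δ + xᵢ ≤ vᵢ, the digit xᵢ < n forcing Δ = 0.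
module Submission where

open import Defs
open import Data.Nat using (_≤_)

open import Level using (0ℓ)
open import Algebra.Bundles using (CommutativeMonoid)
open import Function using (_∘_)
open import Function.Bundles using (_⇔_; mk⇔; Equivalence)
open import Data.Empty using (⊥-elim)
open import Data.Product using (Σ; _×_; _,_; proj₁; proj₂; ∃)
open import Data.Sum using (_⊎_; inj₁; inj₂)
open import Relation.Nullary using (¬_; Dec; yes; no)
open import Relation.Unary using (Pred; Decidable)
open import Relation.Binary.Bundles using (TotalOrder)
open import Relation.Binary.Definitions using (Tri; tri<; tri≈; tri>)
open import Relation.Binary.PropositionalEquality
  using (_≡_; refl; sym; trans; cong; cong₂; subst; subst₂; module ≡-Reasoning)

open import Data.Nat as ℕ using (ℕ; zero; suc)
import Data.Nat.Properties as ℕP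
import Data.Nat.Coprimality as Coprimality
open import Data.Fin as Fin using (Fin; zero; suc; toℕ)
import Data.Fin.Properties as FinP
import Data.Vec.Functional as Vector
open import Data.Integer as ℤ using (ℤ; +_; -[1+_])
import Data.Integer.Properties as ℤP
open import Data.Integer.Tactic.RingSolver using (solve-∀)
open import Data.Rational as ℚ using (ℚ; mkℚ; 0ℚ; 1ℚ)
import Data.Rational.Properties as ℚP
open import Data.Rational.Solver using (module +-*-Solver)
open import Data.Product.Relation.Binary.Lex.NonStrict using (×-totalOrder)

import Algebra.Properties.AbelianGroup ℤP.+-0-abelianGroup as ℤ+
import Algebra.Properties.Group ℚP.+-0-group as ℚ+
import Algebra.Properties.CommutativeSemigroup (CommutativeMonoid.commutativeSemigroup ℚP.+-0-commutativeMonoid) as ℚ+-comm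
import Algebra.Properties.CommutativeSemigroup (CommutativeMonoid.commutativeSemigroup ℚP.*-1-commutativeMonoid) as ℚ*-comm
open import Algebra.Properties.Semiring.Sum ℤP.+-*-semiring
  using (sum-syntax; sum-cong-≗; sum-replicate-zero; ∑-distrib-+; *-distribˡ-sum)

open import Data.List using (List; [_]; allFin; cartesianProductWith; filter)
open import Data.List.Membership.Propositional using (_∈_)
open import Data.List.Membership.Propositional.Properties using (∈-allFin; ∈-cartesianProductWith⁺; ∈-filter⁺)
open import Data.List.Relation.Unary.Any using (here)
import Data.List.Relation.Unary.All as All
open import Data.List.Relation.Unary.All.Properties using (all-filter)
import Data.List.Extrema as Extrema

toℚ : ℤ → ℚ
toℚ i = i ℚ./ 1

toℚ≡mkℚ : ∀ i → toℚ i ≡ mkℚ i 0 (Coprimality.sym (Coprimality.1-coprimeTo ℤ.∣ i ∣))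
toℚ≡mkℚ (+ m)    = ℚP.normalize-coprime (Coprimality.sym (Coprimality.1-coprimeTo m))
toℚ≡mkℚ -[1+ m ] = cong ℚ.-_ (ℚP.normalize-coprime (Coprimality.sym (Coprimality.1-coprimeTo (suc m))))

toℚ-+ : ∀ i j → toℚ (i ℤ.+ j) ≡ toℚ i ℚ.+ toℚ j
toℚ-+ i j rewrite toℚ≡mkℚ i | toℚ≡mkℚ j =
  cong toℚ (cong₂ ℤ._+_ (sym (ℤP.*-identityʳ i)) (sym (ℤP.*-identityʳ j)))

toℚ-* : ∀ i j → toℚ (i ℤ.* j) ≡ toℚ i ℚ.* toℚ j
toℚ-* i j rewrite toℚ≡mkℚ i | toℚ≡mkℚ j = refl

toℚ-neg : ∀ i → toℚ (ℤ.- i) ≡ ℚ.- toℚ i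
toℚ-neg i = ℚ+.inverseˡ-unique (toℚ (ℤ.- i)) (toℚ i)
  (trans (sym (toℚ-+ (ℤ.- i) i)) (cong toℚ (ℤP.+-inverseˡ i)))

toℚ-- : ∀ i j → toℚ (i ℤ.- j) ≡ toℚ i ℚ.- toℚ j
toℚ-- i j = trans (toℚ-+ i (ℤ.- j)) (cong (toℚ i ℚ.+_) (toℚ-neg j))

toℚ-mono-≤ : ∀ {i j} → i ℤ.≤ j → toℚ i ℚ.≤ toℚ j
toℚ-mono-≤ {i} {j} i≤j rewrite toℚ≡mkℚ i | toℚ≡mkℚ j =
  ℚ.*≤* (subst₂ ℤ._≤_ (sym (ℤP.*-identityʳ i)) (sym (ℤP.*-identityʳ j)) i≤j)

toℚ-cancel-≤ : ∀ {i j} → toℚ i ℚ.≤ toℚ j → i ℤ.≤ j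
toℚ-cancel-≤ {i} {j} p rewrite toℚ≡mkℚ i | toℚ≡mkℚ j with p
... | ℚ.*≤* q = subst₂ ℤ._≤_ (ℤP.*-identityʳ i) (ℤP.*-identityʳ j) q

toℚ-injective : ∀ {i j} → toℚ i ≡ toℚ j → i ≡ j
toℚ-injective p = ℤP.≤-antisym (toℚ-cancel-≤ (ℚP.≤-reflexive p)) (toℚ-cancel-≤ (ℚP.≤-reflexive (sym p)))

toℚ-mono-< : ∀ {i j} → i ℤ.< j → toℚ i ℚ.< toℚ j
toℚ-mono-< {i} {j} i<j rewrite toℚ≡mkℚ i | toℚ≡mkℚ j =
  ℚ.*<* (subst₂ ℤ._<_ (sym (ℤP.*-identityʳ i)) (sym (ℤP.*-identityʳ j)) i<j)

sumFin-cong : ∀ m {g h : Fin m → ℚ} → (∀ i → g i ≡ h i) → sumFin m g ≡ sumFin m h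
sumFin-cong zero    g≗h = refl
sumFin-cong (suc m) g≗h = cong₂ ℚ._+_ (g≗h zero) (sumFin-cong m (g≗h ∘ suc))

sumFin-+ : ∀ m (g h : Fin m → ℚ) → sumFin m (λ i → g i ℚ.+ h i) ≡ sumFin m g ℚ.+ sumFin m h
sumFin-+ zero    g h = sym (ℚP.+-identityʳ 0ℚ)
sumFin-+ (suc m) g h = trans (cong (g zero ℚ.+ h zero ℚ.+_) (sumFin-+ m (g ∘ suc) (h ∘ suc)))
                             (ℚ+-comm.interchange (g zero) (h zero) _ _)

sumFin-*ˡ : ∀ m k (g : Fin m → ℚ) → sumFin m (λ i → k ℚ.* g i) ≡ k ℚ.* sumFin m g
sumFin-*ˡ zero    k g = sym (ℚP.*-zeroʳ k)
sumFin-*ˡ (suc m) k g = trans (cong (k ℚ.* g zero ℚ.+_) (sumFin-*ˡ m k (g ∘ suc)))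
                              (sym (ℚP.*-distribˡ-+ k _ _))

sumFin-*ʳ : ∀ m k (g : Fin m → ℚ) → sumFin m (λ i → g i ℚ.* k) ≡ sumFin m g ℚ.* k
sumFin-*ʳ m k g = trans (sumFin-cong m (λ i → ℚP.*-comm (g i) k))
                        (trans (sumFin-*ˡ m k g) (ℚP.*-comm k _))

sumFin-zero : ∀ m → sumFin m (λ _ → 0ℚ) ≡ 0ℚ
sumFin-zero zero    = refl
sumFin-zero (suc m) = trans (ℚP.+-identityˡ _) (sumFin-zero m)

sumFin-comm : ∀ a b (g : Fin a → Fin b → ℚ) →
              sumFin a (λ j → sumFin b (g j)) ≡ sumFin b (λ i → sumFin a (λ j → g j i))
sumFin-comm zero    b g = sym (sumFin-zero b)
sumFin-comm (suc a) b g = trans (cong (sumFin b (g zero) ℚ.+_) (sumFin-comm a b (g ∘ suc)))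
                                (sym (sumFin-+ b (g zero) _))

sumFin-mono-≤ : ∀ m {g h : Fin m → ℚ} → (∀ i → g i ℚ.≤ h i) → sumFin m g ℚ.≤ sumFin m h
sumFin-mono-≤ zero    g≤h = ℚP.≤-refl
sumFin-mono-≤ (suc m) g≤h = ℚP.+-mono-≤ (g≤h zero) (sumFin-mono-≤ m (g≤h ∘ suc))

sumFin-mono-≤-≡ : ∀ m {g h : Fin m → ℚ} → (∀ i → g i ℚ.≤ h i) → sumFin m g ≡ sumFin m h → ∀ i → g i ≡ h i
sumFin-mono-≤-≡ (suc m) {g} {h} g≤h Σg≡Σh = pointwise
  where
  head≡ : g zero ≡ h zero
  head≡ = ℚP.≤-antisym (g≤h zero) (ℚP.≮⇒≥ λ g₀<h₀ →
            ℚP.<-irrefl Σg≡Σh (ℚP.+-mono-<-≤ g₀<h₀ (sumFin-mono-≤ m (g≤h ∘ suc))))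
  tail≡ : sumFin m (g ∘ suc) ≡ sumFin m (h ∘ suc)
  tail≡ = ℚ+.∙-cancelˡ (g zero) _ _ (trans Σg≡Σh (cong (ℚ._+ sumFin m (h ∘ suc)) (sym head≡)))
  pointwise : ∀ i → g i ≡ h i
  pointwise zero    = head≡
  pointwise (suc i) = sumFin-mono-≤-≡ m (g≤h ∘ suc) tail≡ i

p≤q⇒0≤q-p : ∀ {p q} → p ℚ.≤ q → 0ℚ ℚ.≤ q ℚ.- p
p≤q⇒0≤q-p {p} {q} p≤q = subst (ℚ._≤ q ℚ.- p) (ℚP.+-inverseʳ p) (ℚP.+-monoˡ-≤ (ℚ.- p) p≤q)

p<q⇒0<q-p : ∀ {p q} → p ℚ.< q → 0ℚ ℚ.< q ℚ.- p
p<q⇒0<q-p {p} {q} p<q = subst (ℚ._< q ℚ.- p) (ℚP.+-inverseʳ p) (ℚP.+-monoˡ-< (ℚ.- p) p<q)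

*-cancelˡ-≡-pos : ∀ {w p q} → 0ℚ ℚ.< w → w ℚ.* p ≡ w ℚ.* q → p ≡ q
*-cancelˡ-≡-pos {w} 0<w wp≡wq =
  ℚP.≤-antisym (ℚP.*-cancelˡ-≤-pos w (ℚP.≤-reflexive wp≡wq)) (ℚP.*-cancelˡ-≤-pos w (ℚP.≤-reflexive (sym wp≡wq)))
  where instance _ = ℚ.positive 0<w

weighted-≤ : ∀ {w α β} → 0ℚ ℚ.≤ w → (0ℚ ℚ.< w → α ℚ.≤ β) → w ℚ.* α ℚ.≤ w ℚ.* β
weighted-≤ {w} {α} {β} 0≤w α≤β with ℚP.<-cmp 0ℚ w
... | tri< 0<w _ _ = ℚP.*-monoˡ-≤-nonNeg w {{ℚ.nonNegative 0≤w}} (α≤β 0<w)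
... | tri≈ _ refl _ = ℚP.≤-reflexive (trans (ℚP.*-zeroˡ α) (sym (ℚP.*-zeroˡ β)))
... | tri> _ _ w<0 = ⊥-elim (ℚP.<-irrefl refl (ℚP.<-≤-trans w<0 0≤w))

weighted-≡ : ∀ {w α β} → 0ℚ ℚ.≤ w → (0ℚ ℚ.< w → α ≡ β) → w ℚ.* α ≡ w ℚ.* β
weighted-≡ 0≤w α≡β = ℚP.≤-antisym (weighted-≤ 0≤w (ℚP.≤-reflexive ∘ α≡β))
                                 (weighted-≤ 0≤w (ℚP.≤-reflexive ∘ sym ∘ α≡β))

⟨_,_⟩ : ∀ {d} → Vecℚ d → Vecℚ d → ℚ
⟨_,_⟩ {d} c y = sumFin d (λ j → c j ℚ.* y j)

⟨⟩-congʳ : ∀ {d} (c : Vecℚ d) {y y′ : Vecℚ d} → y ≈ᵥ y′ → ⟨ c , y ⟩ ≡ ⟨ c , y′ ⟩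
⟨⟩-congʳ {d} c y≈y′ = sumFin-cong d (λ j → cong (c j ℚ.*_) (y≈y′ j))

⟨⟩-sumFin : ∀ {d} (c : Vecℚ d) m (w : Fin m → ℚ) (q : Fin m → Vecℚ d) →
            ⟨ c , (λ j → sumFin m (λ i → w i ℚ.* q i j)) ⟩ ≡ sumFin m (λ i → w i ℚ.* ⟨ c , q i ⟩)
⟨⟩-sumFin {d} c m w q = begin
  sumFin d (λ j → c j ℚ.* sumFin m (λ i → w i ℚ.* q i j))    ≡⟨ sumFin-cong d (λ j → sym (sumFin-*ˡ m (c j) _)) ⟩
  sumFin d (λ j → sumFin m (λ i → c j ℚ.* (w i ℚ.* q i j)))  ≡⟨ sumFin-comm d m _ ⟩
  sumFin m (λ i → sumFin d (λ j → c j ℚ.* (w i ℚ.* q i j)))  ≡⟨ sumFin-cong m (λ i → trans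
                                                                   (sumFin-cong d (λ j → ℚ*-comm.x∙yz≈y∙xz (c j) (w i) (q i j)))
                                                                   (sumFin-*ˡ d (w i) _)) ⟩
  sumFin m (λ i → w i ℚ.* ⟨ c , q i ⟩)                        ∎
  where open ≡-Reasoning

⟨⟩-segment : ∀ {d} (c a b : Vecℚ d) t →
             ⟨ c , (λ j → (1ℚ ℚ.- t) ℚ.* a j ℚ.+ t ℚ.* b j) ⟩ ≡ (1ℚ ℚ.- t) ℚ.* ⟨ c , a ⟩ ℚ.+ t ℚ.* ⟨ c , b ⟩
⟨⟩-segment {d} c a b t = begin
  sumFin d (λ j → c j ℚ.* ((1ℚ ℚ.- t) ℚ.* a j ℚ.+ t ℚ.* b j))
    ≡⟨ sumFin-cong d (λ j → distrib (c j) (a j) (b j)) ⟩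
  sumFin d (λ j → (1ℚ ℚ.- t) ℚ.* (c j ℚ.* a j) ℚ.+ t ℚ.* (c j ℚ.* b j))
    ≡⟨ sumFin-+ d _ _ ⟩
  sumFin d (λ j → (1ℚ ℚ.- t) ℚ.* (c j ℚ.* a j)) ℚ.+ sumFin d (λ j → t ℚ.* (c j ℚ.* b j))
    ≡⟨ cong₂ ℚ._+_ (sumFin-*ˡ d (1ℚ ℚ.- t) _) (sumFin-*ˡ d t _) ⟩
  (1ℚ ℚ.- t) ℚ.* ⟨ c , a ⟩ ℚ.+ t ℚ.* ⟨ c , b ⟩
    ∎
  where
  open ≡-Reasoning
  distrib : ∀ x y z → x ℚ.* ((1ℚ ℚ.- t) ℚ.* y ℚ.+ t ℚ.* z) ≡ (1ℚ ℚ.- t) ℚ.* (x ℚ.* y) ℚ.+ t ℚ.* (x ℚ.* z)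
  distrib x y z = trans (ℚP.*-distribˡ-+ x ((1ℚ ℚ.- t) ℚ.* y) (t ℚ.* z))
                        (cong₂ ℚ._+_ (ℚ*-comm.x∙yz≈y∙xz x (1ℚ ℚ.- t) y) (ℚ*-comm.x∙yz≈y∙xz x t z))

convex-squeeze : ∀ {r α β t} → r ℚ.≤ α → r ℚ.≤ β → 0ℚ ℚ.< t → t ℚ.< 1ℚ →
                 (1ℚ ℚ.- t) ℚ.* α ℚ.+ t ℚ.* β ≡ r → α ≡ r × β ≡ r
convex-squeeze {r} {α} {β} {t} r≤α r≤β 0<t t<1 avg≡r =
  ℚP.≤-antisym (ℚP.≮⇒≥ (λ r<α → not-above (ℚP.+-mono-<-≤ (strict r<α) (weak t≥0 r≤β)))) r≤α ,
  ℚP.≤-antisym (ℚP.≮⇒≥ (λ r<β → not-above (ℚP.+-mono-≤-< (weak 1-t≥0 r≤α) (strict′ r<β)))) r≤β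
  where
  1-t≥0 = ℚP.<⇒≤ (p<q⇒0<q-p t<1)
  t≥0 = ℚP.<⇒≤ 0<t
  weak : ∀ {w x y} → 0ℚ ℚ.≤ w → x ℚ.≤ y → w ℚ.* x ℚ.≤ w ℚ.* y
  weak {w} 0≤w = ℚP.*-monoˡ-≤-nonNeg w {{ℚ.nonNegative 0≤w}}
  strict : r ℚ.< α → (1ℚ ℚ.- t) ℚ.* r ℚ.< (1ℚ ℚ.- t) ℚ.* α
  strict = ℚP.*-monoʳ-<-pos (1ℚ ℚ.- t) {{ℚ.positive (p<q⇒0<q-p t<1)}}
  strict′ : r ℚ.< β → t ℚ.* r ℚ.< t ℚ.* β
  strict′ = ℚP.*-monoʳ-<-pos t {{ℚ.positive 0<t}}
  split : ∀ s x → (1ℚ ℚ.- s) ℚ.* x ℚ.+ s ℚ.* x ≡ x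
  split = solve 2 (λ s x → (con 1ℚ :- s) :* x :+ s :* x := x) refl
    where open +-*-Solver
  not-above : ¬ ((1ℚ ℚ.- t) ℚ.* r ℚ.+ t ℚ.* r ℚ.< (1ℚ ℚ.- t) ℚ.* α ℚ.+ t ℚ.* β)
  not-above = ℚP.<-irrefl (trans (split t r) (sym avg≡r))

-- Convex combinations of grid points

M₁ : ∀ {n d} → BoolFun n d → E n d → Set
M₁ = M (suc zero)

Face : ∀ {n d} → (E n d → Set) → Vecℚ d → ℚ → E n d → Set
Face S c r z = S z × ⟨ c , emb z ⟩ ≡ r

-- Only the points of positive weight are required to lie in S, so that a
-- combination stays in the hull when S shrinks to a face.
record Hull {n d} (S : E n d → Set) (y : Vecℚ d) : Set where
  field
    size          : ℕ
    point         : Fin size → E n d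
    weight        : Fin size → ℚ
    support       : ∀ i → 0ℚ ℚ.< weight i → S (point i)
    weight-nonNeg : ∀ i → 0ℚ ℚ.≤ weight i
    weight-sum    : sumFin size weight ≡ 1ℚ
    combination   : y ≈ᵥ (λ j → sumFin size (λ i → weight i ℚ.* emb (point i) j))

module _ {n d : ℕ} where

  InP⇒Hull : ∀ (f : BoolFun n d) {y} → InP f y → Hull (M₁ f) y
  InP⇒Hull f (m , p , w , p∈M₁ , 0≤w , Σw≡1 , y≈) = record
    { size = m ; point = p ; weight = w ; support = λ i _ → p∈M₁ i
    ; weight-nonNeg = 0≤w ; weight-sum = Σw≡1 ; combination = y≈ }

  module _ {S : E n d → Set} {y : Vecℚ d} (h : Hull S y) where
    open Hull h

    ⟨⟩-Hull : ∀ c → ⟨ c , y ⟩ ≡ sumFin size (λ i → weight i ℚ.* ⟨ c , emb (point i) ⟩)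
    ⟨⟩-Hull c = trans (⟨⟩-congʳ c combination) (⟨⟩-sumFin c size weight (emb ∘ point))

    weighted-const : ∀ r → sumFin size (λ i → weight i ℚ.* r) ≡ r
    weighted-const r = trans (sumFin-*ʳ size r weight) (trans (cong (ℚ._* r) weight-sum) (ℚP.*-identityˡ r))

    weighted-bound : ∀ c r → (∀ z → S z → r ℚ.≤ ⟨ c , emb z ⟩) →
                     ∀ i → weight i ℚ.* r ℚ.≤ weight i ℚ.* ⟨ c , emb (point i) ⟩
    weighted-bound c r r≤S i = weighted-≤ (weight-nonNeg i) (r≤S _ ∘ support i)

    Hull-lower-bound : ∀ c r → (∀ z → S z → r ℚ.≤ ⟨ c , emb z ⟩) → r ℚ.≤ ⟨ c , y ⟩
    Hull-lower-bound c r r≤S = begin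
      r                                                     ≡⟨ weighted-const r ⟨
      sumFin size (λ i → weight i ℚ.* r)                     ≤⟨ sumFin-mono-≤ size (weighted-bound c r r≤S) ⟩
      sumFin size (λ i → weight i ℚ.* ⟨ c , emb (point i) ⟩) ≡⟨ ⟨⟩-Hull c ⟨
      ⟨ c , y ⟩                                             ∎
      where open ℚP.≤-Reasoning

    Hull-face : ∀ c r → (∀ z → S z → r ℚ.≤ ⟨ c , emb z ⟩) → ⟨ c , y ⟩ ≡ r → Hull (Face S c r) y
    Hull-face c r r≤S ⟨c,y⟩≡r = record
      { size = size ; point = point ; weight = weight ; support = support′
      ; weight-nonNeg = weight-nonNeg ; weight-sum = weight-sum ; combination = combination }
      where
      tight : ∀ i → weight i ℚ.* r ≡ weight i ℚ.* ⟨ c , emb (point i) ⟩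
      tight = sumFin-mono-≤-≡ size (weighted-bound c r r≤S)
                (trans (weighted-const r) (trans (sym ⟨c,y⟩≡r) (⟨⟩-Hull c)))
      support′ : ∀ i → 0ℚ ℚ.< weight i → Face S c r (point i)
      support′ i 0<wᵢ = support i 0<wᵢ , sym (*-cancelˡ-≡-pos 0<wᵢ (tight i))

    Hull-singleton : ∀ {x} → (∀ z → S z → emb z ≈ᵥ x) → y ≈ᵥ x
    Hull-singleton {x} S⊆x j = begin
      y j                                             ≡⟨ combination j ⟩
      sumFin size (λ i → weight i ℚ.* emb (point i) j) ≡⟨ sumFin-cong size (λ i →
                                                            weighted-≡ (weight-nonNeg i) (λ 0<wᵢ → S⊆x _ (support i 0<wᵢ) j)) ⟩
      sumFin size (λ i → weight i ℚ.* x j)            ≡⟨ weighted-const (x j) ⟩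
      x j                                             ∎
      where open ≡-Reasoning

  segment-in-face : ∀ {S : E n d → Set} c r {a b t} → (∀ z → S z → r ℚ.≤ ⟨ c , emb z ⟩) →
                    Hull S a → Hull S b → 0ℚ ℚ.< t → t ℚ.< 1ℚ →
                    ⟨ c , (λ j → (1ℚ ℚ.- t) ℚ.* a j ℚ.+ t ℚ.* b j) ⟩ ≡ r →
                    Hull (Face S c r) a × Hull (Face S c r) b
  segment-in-face c r {a} {b} {t} r≤S ha hb 0<t t<1 ⟨c,y⟩≡r =
    Hull-face ha c r r≤S ⟨c,a⟩≡r , Hull-face hb c r r≤S ⟨c,b⟩≡r
    where
    squeezed = convex-squeeze (Hull-lower-bound ha c r r≤S) (Hull-lower-bound hb c r r≤S) 0<t t<1
                              (trans (sym (⟨⟩-segment c a b t)) ⟨c,y⟩≡r)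
    ⟨c,a⟩≡r = proj₁ squeezed
    ⟨c,b⟩≡r = proj₂ squeezed

  lexmin⇒extreme : ∀ {S : E n d → Set} {w : E n d} (c₁ c₂ : Vecℚ d) →
                   (∀ z → S z → ⟨ c₁ , emb w ⟩ ℚ.≤ ⟨ c₁ , emb z ⟩) →
                   (∀ z → Face S c₁ ⟨ c₁ , emb w ⟩ z → ⟨ c₂ , emb w ⟩ ℚ.≤ ⟨ c₂ , emb z ⟩) →
                   (∀ z → Face (Face S c₁ ⟨ c₁ , emb w ⟩) c₂ ⟨ c₂ , emb w ⟩ z → emb z ≈ᵥ emb w) →
                   ∀ {a b t} → Hull S a → Hull S b → 0ℚ ℚ.< t → t ℚ.< 1ℚ →
                   emb w ≈ᵥ (λ j → (1ℚ ℚ.- t) ℚ.* a j ℚ.+ t ℚ.* b j) → a ≈ᵥ b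
  lexmin⇒extreme c₁ c₂ min₁ min₂ unique ha hb 0<t t<1 w≈ j =
    trans (Hull-singleton ha₂ unique j) (sym (Hull-singleton hb₂ unique j))
    where
    face₁ = segment-in-face c₁ _ min₁ ha hb 0<t t<1 (sym (⟨⟩-congʳ c₁ w≈))
    face₂ = segment-in-face c₂ _ min₂ (proj₁ face₁) (proj₂ face₁) 0<t t<1 (sym (⟨⟩-congʳ c₂ w≈))
    ha₂ = proj₁ face₂
    hb₂ = proj₂ face₂

collinear⇒segment : ∀ {d} (a b y : Vecℚ d) i → a i ℚ.< b i → a i ℚ.≤ y i → y i ℚ.≤ b i →
                    (∀ j → (b i ℚ.- a i) ℚ.* (y j ℚ.- a j) ≡ (b j ℚ.- a j) ℚ.* (y i ℚ.- a i)) →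
                    ∃ λ s → 0ℚ ℚ.≤ s × s ℚ.≤ 1ℚ × y ≈ᵥ (λ j → (1ℚ ℚ.- s) ℚ.* a j ℚ.+ s ℚ.* b j)
collinear⇒segment a b y i aᵢ<bᵢ aᵢ≤yᵢ yᵢ≤bᵢ collinear = s , 0≤s , s≤1 , y≈
  where
  L = b i ℚ.- a i
  0<L : 0ℚ ℚ.< L
  0<L = p<q⇒0<q-p aᵢ<bᵢ
  instance
    L-pos : ℚ.Positive L
    L-pos = ℚ.positive 0<L
    L≢0 : ℚ.NonZero L
    L≢0 = ℚP.pos⇒nonZero L
  1/L-nonNeg : ℚ.NonNegative (ℚ.1/ L)
  1/L-nonNeg = ℚP.pos⇒nonNeg (ℚ.1/ L) {{ℚP.1/pos⇒pos L}}
  s = (y i ℚ.- a i) ℚ.* ℚ.1/ L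
  0≤s : 0ℚ ℚ.≤ s
  0≤s = subst (ℚ._≤ s) (ℚP.*-zeroˡ (ℚ.1/ L))
    (ℚP.*-monoʳ-≤-nonNeg (ℚ.1/ L) {{1/L-nonNeg}} (p≤q⇒0≤q-p aᵢ≤yᵢ))
  s≤1 : s ℚ.≤ 1ℚ
  s≤1 = subst (s ℚ.≤_) (ℚP.*-inverseʳ L) (ℚP.*-monoʳ-≤-nonNeg (ℚ.1/ L) {{1/L-nonNeg}} (ℚP.+-monoˡ-≤ (ℚ.- a i) yᵢ≤bᵢ))
  y≈ : ∀ j → y j ≡ (1ℚ ℚ.- s) ℚ.* a j ℚ.+ s ℚ.* b j
  y≈ j = sym (begin
    (1ℚ ℚ.- s) ℚ.* a j ℚ.+ s ℚ.* b j            ≡⟨ regroup (y i ℚ.- a i) (ℚ.1/ L) (a j) (b j) ⟩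
    a j ℚ.+ ℚ.1/ L ℚ.* ((b j ℚ.- a j) ℚ.* (y i ℚ.- a i)) ≡⟨ cong (λ z → a j ℚ.+ ℚ.1/ L ℚ.* z) (collinear j) ⟨
    a j ℚ.+ ℚ.1/ L ℚ.* (L ℚ.* (y j ℚ.- a j))     ≡⟨ cong (a j ℚ.+_) (ℚP.*-assoc (ℚ.1/ L) L _) ⟨
    a j ℚ.+ ℚ.1/ L ℚ.* L ℚ.* (y j ℚ.- a j)       ≡⟨ cong (λ z → a j ℚ.+ z ℚ.* (y j ℚ.- a j)) (ℚP.*-inverseˡ L) ⟩
    a j ℚ.+ 1ℚ ℚ.* (y j ℚ.- a j)                ≡⟨ collapse (a j) (y j) ⟩
    y j                                         ∎)
    where
    open ≡-Reasoning
    open +-*-Solver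
    regroup : ∀ δ r aⱼ bⱼ → (1ℚ ℚ.- δ ℚ.* r) ℚ.* aⱼ ℚ.+ δ ℚ.* r ℚ.* bⱼ ≡ aⱼ ℚ.+ r ℚ.* ((bⱼ ℚ.- aⱼ) ℚ.* δ)
    regroup = solve 4 (λ δ r aⱼ bⱼ → (con 1ℚ :- δ :* r) :* aⱼ :+ δ :* r :* bⱼ := aⱼ :+ r :* ((bⱼ :- aⱼ) :* δ)) refl
    collapse : ∀ aⱼ yⱼ → aⱼ ℚ.+ 1ℚ ℚ.* (yⱼ ℚ.- aⱼ) ≡ yⱼ
    collapse = solve 2 (λ aⱼ yⱼ → aⱼ :+ con 1ℚ :* (yⱼ :- aⱼ) := yⱼ) refl

-- Integer linear forms

_∙_ : ∀ {d} → (Fin d → ℤ) → (Fin d → ℤ) → ℤ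
_∙_ {d} c x = ∑[ j < d ] (c j ℤ.* x j)

∙-congʳ : ∀ {d} (c : Fin d → ℤ) {x y : Fin d → ℤ} → (∀ j → x j ≡ y j) → c ∙ x ≡ c ∙ y
∙-congʳ c x≗y = sum-cong-≗ (λ j → cong (c j ℤ.*_) (x≗y j))

∙-linearˡ : ∀ {d} α β (c c′ x : Fin d → ℤ) →
            (λ j → α ℤ.* c j ℤ.+ β ℤ.* c′ j) ∙ x ≡ α ℤ.* (c ∙ x) ℤ.+ β ℤ.* (c′ ∙ x)
∙-linearˡ {d} α β c c′ x = begin
  ∑[ j < d ] ((α ℤ.* c j ℤ.+ β ℤ.* c′ j) ℤ.* x j)           ≡⟨ sum-cong-≗ (λ j → distrib α β (c j) (c′ j) (x j)) ⟩
  ∑[ j < d ] (α ℤ.* (c j ℤ.* x j) ℤ.+ β ℤ.* (c′ j ℤ.* x j)) ≡⟨ ∑-distrib-+ (λ j → α ℤ.* (c j ℤ.* x j)) _ ⟩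
  ∑[ j < d ] (α ℤ.* (c j ℤ.* x j)) ℤ.+ ∑[ j < d ] (β ℤ.* (c′ j ℤ.* x j))
       ≡⟨ cong₂ ℤ._+_ (*-distribˡ-sum α (λ j → c j ℤ.* x j)) (*-distribˡ-sum β (λ j → c′ j ℤ.* x j)) ⟨
  α ℤ.* (c ∙ x) ℤ.+ β ℤ.* (c′ ∙ x)                        ∎
  where
  open ≡-Reasoning
  distrib : ∀ α β a b x → (α ℤ.* a ℤ.+ β ℤ.* b) ℤ.* x ≡ α ℤ.* (a ℤ.* x) ℤ.+ β ℤ.* (b ℤ.* x)
  distrib = solve-∀

∙-comm : ∀ {d} (c x : Fin d → ℤ) → c ∙ x ≡ x ∙ c
∙-comm c x = sum-cong-≗ (λ j → ℤP.*-comm (c j) (x j))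

∙-linearʳ : ∀ {d} α β (c x y : Fin d → ℤ) →
            c ∙ (λ j → α ℤ.* x j ℤ.+ β ℤ.* y j) ≡ α ℤ.* (c ∙ x) ℤ.+ β ℤ.* (c ∙ y)
∙-linearʳ α β c x y = trans (∙-comm c _) (trans (∙-linearˡ α β x y c)
                        (cong₂ (λ p q → α ℤ.* p ℤ.+ β ℤ.* q) (∙-comm x c) (∙-comm y c)))

∙-negˡ : ∀ {d} (c x : Fin d → ℤ) → (λ j → ℤ.- c j) ∙ x ≡ ℤ.- (c ∙ x)
∙-negˡ {d} c x = begin
  ∑[ j < d ] (ℤ.- c j ℤ.* x j)           ≡⟨ sum-cong-≗ (λ j → trans (sym (ℤP.neg-distribˡ-* (c j) (x j)))
                                                               (sym (ℤP.-1*i≡-i _))) ⟩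
  ∑[ j < d ] (ℤ.-1ℤ ℤ.* (c j ℤ.* x j))   ≡⟨ *-distribˡ-sum ℤ.-1ℤ (λ j → c j ℤ.* x j) ⟨
  ℤ.-1ℤ ℤ.* (c ∙ x)                     ≡⟨ ℤP.-1*i≡-i _ ⟩
  ℤ.- (c ∙ x)                           ∎
  where open ≡-Reasoning

δ : ∀ {d} → Fin d → Fin d → ℤ
δ zero    zero    = ℤ.1ℤ
δ zero    (suc _) = ℤ.0ℤ
δ (suc _) zero    = ℤ.0ℤ
δ (suc i) (suc j) = δ i j

δ-∙ : ∀ {d} (i : Fin d) (x : Fin d → ℤ) → δ i ∙ x ≡ x i
δ-∙ {suc d} zero    x = begin
  ℤ.1ℤ ℤ.* x zero ℤ.+ ∑[ j < d ] (ℤ.0ℤ ℤ.* x (suc j)) ≡⟨ cong (ℤ._+_ (ℤ.1ℤ ℤ.* x zero))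
                                                          (trans (sum-cong-≗ (ℤP.*-zeroˡ ∘ x ∘ suc)) (sum-replicate-zero d)) ⟩
  ℤ.1ℤ ℤ.* x zero ℤ.+ ℤ.0ℤ                           ≡⟨ ℤP.+-identityʳ _ ⟩
  ℤ.1ℤ ℤ.* x zero                                    ≡⟨ ℤP.*-identityˡ _ ⟩
  x zero                                             ∎
  where open ≡-Reasoning
δ-∙ {suc d} (suc i) x = trans (ℤP.+-identityˡ _) (δ-∙ i (x ∘ suc))

toℚ-∙ : ∀ {d} (c x : Fin d → ℤ) → toℚ (c ∙ x) ≡ ⟨ toℚ ∘ c , toℚ ∘ x ⟩
toℚ-∙ {zero}  c x = refl
toℚ-∙ {suc d} c x = begin
  toℚ (c zero ℤ.* x zero ℤ.+ (c ∘ suc) ∙ (x ∘ suc))         ≡⟨ toℚ-+ (c zero ℤ.* x zero) _ ⟩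
  toℚ (c zero ℤ.* x zero) ℚ.+ toℚ ((c ∘ suc) ∙ (x ∘ suc))   ≡⟨ cong₂ ℚ._+_ (toℚ-* (c zero) (x zero))
                                                                           (toℚ-∙ (c ∘ suc) (x ∘ suc)) ⟩
  toℚ (c zero) ℚ.* toℚ (x zero) ℚ.+ ⟨ toℚ ∘ c ∘ suc , toℚ ∘ x ∘ suc ⟩ ∎
  where open ≡-Reasoning

pow : ℤ → ∀ {d} → Fin d → ℤ
pow N zero    = ℤ.1ℤ
pow N (suc j) = N ℤ.* pow N j

pow-∙-suc : ∀ N {d} (w : Fin (suc d) → ℤ) → pow N ∙ w ≡ w zero ℤ.+ N ℤ.* (pow N ∙ (w ∘ suc))
pow-∙-suc N {d} w = cong₂ ℤ._+_ (ℤP.*-identityˡ (w zero)) (begin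
  ∑[ j < d ] (N ℤ.* pow N j ℤ.* w (suc j))   ≡⟨ sum-cong-≗ (λ j → ℤP.*-assoc N (pow N j) (w (suc j))) ⟩
  ∑[ j < d ] (N ℤ.* (pow N j ℤ.* w (suc j))) ≡⟨ *-distribˡ-sum N (λ j → pow N j ℤ.* w (suc j)) ⟨
  N ℤ.* (pow N ∙ (w ∘ suc))                  ∎)
  where open ≡-Reasoning

digit+base*r≡0 : ∀ N a r → ℤ.∣ a ∣ ℕ.< N → a ℤ.+ + N ℤ.* r ≡ ℤ.0ℤ → r ≡ ℤ.0ℤ
digit+base*r≡0 N a r ∣a∣<N a+Nr≡0 = ℤP.∣i∣≡0⇒i≡0 (ℕP.n<1⇒n≡0 (ℕP.*-cancelˡ-< N ℤ.∣ r ∣ 1 (begin-strict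
  N ℕ.* ℤ.∣ r ∣          ≡⟨ ℤP.abs-* (+ N) r ⟨
  ℤ.∣ + N ℤ.* r ∣        ≡⟨ ℤP.∣-i∣≡∣i∣ (+ N ℤ.* r) ⟨
  ℤ.∣ ℤ.- (+ N ℤ.* r) ∣  ≡⟨ cong ℤ.∣_∣ (ℤ+.inverseˡ-unique a (+ N ℤ.* r) a+Nr≡0) ⟨
  ℤ.∣ a ∣                <⟨ ∣a∣<N ⟩
  N                      ≡⟨ ℕP.*-identityʳ N ⟨
  N ℕ.* 1                ∎)))
  where open ℕP.≤-Reasoning

pow-digits-zero : ∀ N {d} (w : Fin d → ℤ) → (∀ j → ℤ.∣ w j ∣ ℕ.< N) → pow (+ N) ∙ w ≡ ℤ.0ℤ →
                  ∀ j → w j ≡ ℤ.0ℤ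
pow-digits-zero N {suc d} w ∣w∣<N Σ≡0 = digits
  where
  Σ′≡0 : pow (+ N) ∙ (w ∘ suc) ≡ ℤ.0ℤ
  Σ′≡0 = digit+base*r≡0 N (w zero) (pow (+ N) ∙ (w ∘ suc)) (∣w∣<N zero) (trans (sym (pow-∙-suc (+ N) w)) Σ≡0)
  digits : ∀ j → w j ≡ ℤ.0ℤ
  digits zero    = begin
    w zero                                         ≡⟨ ℤP.+-identityʳ (w zero) ⟨
    w zero ℤ.+ ℤ.0ℤ                                ≡⟨ cong (ℤ._+_ (w zero)) (ℤP.*-zeroʳ (+ N)) ⟨
    w zero ℤ.+ + N ℤ.* ℤ.0ℤ                        ≡⟨ cong (λ r → w zero ℤ.+ + N ℤ.* r) Σ′≡0 ⟨
    w zero ℤ.+ + N ℤ.* (pow (+ N) ∙ (w ∘ suc))      ≡⟨ pow-∙-suc (+ N) w ⟨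
    pow (+ N) ∙ w                                  ≡⟨ Σ≡0 ⟩
    ℤ.0ℤ                                           ∎
    where open ≡-Reasoning
  digits (suc j) = pow-digits-zero N (w ∘ suc) (∣w∣<N ∘ suc) Σ′≡0 j

∙-−ʳ : ∀ {d} (c x y : Fin d → ℤ) → c ∙ (λ j → x j ℤ.- y j) ≡ c ∙ x ℤ.- c ∙ y
∙-−ʳ c x y = begin
  c ∙ (λ j → x j ℤ.- y j)                   ≡⟨ ∙-congʳ c (λ j → as-combination (x j) (y j)) ⟩
  c ∙ (λ j → ℤ.1ℤ ℤ.* x j ℤ.+ ℤ.-1ℤ ℤ.* y j) ≡⟨ ∙-linearʳ ℤ.1ℤ ℤ.-1ℤ c x y ⟩
  ℤ.1ℤ ℤ.* (c ∙ x) ℤ.+ ℤ.-1ℤ ℤ.* (c ∙ y)    ≡⟨ as-combination (c ∙ x) (c ∙ y) ⟨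
  c ∙ x ℤ.- c ∙ y                           ∎
  where
  open ≡-Reasoning
  as-combination : ∀ a b → a ℤ.- b ≡ ℤ.1ℤ ℤ.* a ℤ.+ ℤ.-1ℤ ℤ.* b
  as-combination = solve-∀

+-cancelˡ-≤ : ∀ b {p q} → b ℤ.+ p ℤ.≤ b ℤ.+ q → p ℤ.≤ q
+-cancelˡ-≤ b {p} {q} b+p≤b+q = subst₂ ℤ._≤_ (cancel b p) (cancel b q) (ℤP.+-monoʳ-≤ (ℤ.- b) b+p≤b+q)
  where
  cancel : ∀ b p → ℤ.- b ℤ.+ (b ℤ.+ p) ≡ p
  cancel = solve-∀

∙-zeroʳ : ∀ {d} (c : Fin d → ℤ) → c ∙ (λ _ → ℤ.0ℤ) ≡ ℤ.0ℤ
∙-zeroʳ {d} c = trans (sum-cong-≗ (ℤP.*-zeroʳ ∘ c)) (sum-replicate-zero d)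

∣+m-+n∣<K : ∀ {K m n} → m ℕ.< K → n ℕ.< K → ℤ.∣ + m ℤ.- + n ∣ ℕ.< K
∣+m-+n∣<K {K} {m} {n} m<K n<K = begin-strict
  ℤ.∣ + m ℤ.- + n ∣  ≡⟨ cong ℤ.∣_∣ (ℤP.[+m]-[+n]≡m⊖n m n) ⟩
  ℤ.∣ m ℤ.⊖ n ∣      ≤⟨ ℤP.∣m⊝n∣≤m⊔n m n ⟩
  m ℕ.⊔ n            <⟨ ℕP.⊔-pres-<m m<K n<K ⟩
  K                  ∎
  where open ℕP.≤-Reasoning

window-zero : ∀ K Δ {l lo hi} → l ℕ.< K → hi ℕ.< K →
              + lo ℤ.≤ + K ℤ.* Δ ℤ.+ + l → + K ℤ.* Δ ℤ.+ + l ℤ.≤ + hi → Δ ≡ ℤ.0ℤ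
window-zero K Δ {l} {lo} {hi} l<K hi<K lo≤t t≤hi =
  digit+base*r≡0 K (+ l ℤ.- t) Δ (subst (λ t → ℤ.∣ + l ℤ.- t ∣ ℕ.< K) +∣t∣≡t (∣+m-+n∣<K l<K ∣t∣<K))
                 (cancel (+ K ℤ.* Δ) (+ l))
  where
  t = + K ℤ.* Δ ℤ.+ + l
  +∣t∣≡t : + ℤ.∣ t ∣ ≡ t
  +∣t∣≡t = ℤP.0≤i⇒+∣i∣≡i (ℤP.≤-trans (ℤ.+≤+ ℕ.z≤n) lo≤t)
  ∣t∣<K : ℤ.∣ t ∣ ℕ.< K
  ∣t∣<K = ℕP.≤-<-trans (ℤP.drop‿+≤+ (subst (ℤ._≤ + hi) (sym +∣t∣≡t) t≤hi)) hi<K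
  cancel : ∀ a b → b ℤ.- (a ℤ.+ b) ℤ.+ a ≡ ℤ.0ℤ
  cancel = solve-∀

-- The grid

grid : ∀ {n d} → E n d → Fin d → ℤ
grid x j = + toℕ (x j)

∣grid-grid∣<n : ∀ {n d} (x y : E n d) j → ℤ.∣ grid x j ℤ.- grid y j ∣ ℕ.< n
∣grid-grid∣<n x y j = ∣+m-+n∣<K (FinP.toℕ<n (x j)) (FinP.toℕ<n (y j))

pow-∙-grid-injective : ∀ {n d} (x y : E n d) → pow (+ n) ∙ grid x ≡ pow (+ n) ∙ grid y → ∀ j → x j ≡ y j
pow-∙-grid-injective {n} x y eq j =
  FinP.toℕ-injective (ℤP.+-injective (ℤP.i-j≡0⇒i≡j _ _ (pow-digits-zero n _ (∣grid-grid∣<n x y) Σ≡0 j)))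
  where
  Σ≡0 : pow (+ n) ∙ (λ j → grid x j ℤ.- grid y j) ≡ ℤ.0ℤ
  Σ≡0 = trans (∙-−ʳ (pow (+ n)) (grid x) (grid y)) (ℤP.i≡j⇒i-j≡0 eq)

grid-points : ∀ n d → List (E n d)
grid-points n zero    = [ (λ ()) ]
grid-points n (suc d) = cartesianProductWith Vector._∷_ (allFin n) (grid-points n d)

-- Functions are compared pointwise: without function extensionality a point
-- is only listed up to ≗.
grid-points-complete : ∀ {n d} (x : E n d) → ∃ λ y → y ∈ grid-points n d × (∀ j → x j ≡ y j)
grid-points-complete {d = zero}  x = (λ ()) , here refl , λ ()
grid-points-complete {d = suc d} x with grid-points-complete (x ∘ suc)
... | y , y∈ , x′≗y = x zero Vector.∷ y , ∈-cartesianProductWith⁺ Vector._∷_ (∈-allFin (x zero)) y∈ ,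
                      λ { zero → refl ; (suc j) → x′≗y j }

module _ {a ℓ₁ ℓ₂} (O : TotalOrder a ℓ₁ ℓ₂) where
  open TotalOrder O using (Carrier) renaming (_≤_ to _≼_)
  open Extrema O using (argmin; argmin-all; f[argmin]≤f[xs])

  grid-argmin : ∀ {n d p} {P : Pred (E n d) p} → Decidable P → (key : E n d → Carrier) →
                (∀ {x y} → (∀ j → x j ≡ y j) → P x → P y) →
                (∀ {x y} → (∀ j → x j ≡ y j) → key x ≡ key y) →
                ∀ {x₀} → P x₀ → ∃ λ w → P w × ∀ z → P z → key w ≼ key z
  grid-argmin {n} {d} {P = P} P? key P-resp key-resp {x₀} Px₀ =
    w , argmin-all key Px₀ (all-filter P? (grid-points n d)) , minimal
    where
    candidates = filter P? (grid-points n d)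
    w = argmin key x₀ candidates
    minimal : ∀ z → P z → key w ≼ key z
    minimal z Pz with grid-points-complete z
    ... | y , y∈ , z≗y = subst (key w ≼_) (key-resp (sym ∘ z≗y))
                               (All.lookup (f[argmin]≤f[xs] x₀ candidates) (∈-filter⁺ P? y∈ (P-resp z≗y Pz)))

emb-cong : ∀ {n d} {x y : E n d} → (∀ j → x j ≡ y j) → emb x ≈ᵥ emb y
emb-cong x≗y j = cong (λ k → + toℕ k ℚ./ 1) (x≗y j)

emb-injective : ∀ {n d} {x y : E n d} → emb x ≈ᵥ emb y → ∀ j → x j ≡ y j
emb-injective x≈y j = FinP.toℕ-injective (ℤP.+-injective (toℚ-injective (x≈y j)))

∙-grid-cong : ∀ {n d} (c : Fin d → ℤ) {x y : E n d} → (∀ j → x j ≡ y j) → c ∙ grid x ≡ c ∙ grid y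
∙-grid-cong c x≗y = ∙-congʳ c (λ j → cong (+_ ∘ toℕ) (x≗y j))

⟨⟩-grid : ∀ {n d} (c : Fin d → ℤ) (x : E n d) → ⟨ toℚ ∘ c , emb x ⟩ ≡ toℚ (c ∙ grid x)
⟨⟩-grid c x = sym (toℚ-∙ c (grid x))

Lex : TotalOrder 0ℓ 0ℓ 0ℓ
Lex = ×-totalOrder ℤP.≤-decTotalOrder ℤP.≤-totalOrder

_≤ₗₑₓ_ : ℤ × ℤ → ℤ × ℤ → Set
_≤ₗₑₓ_ = TotalOrder._≤_ Lex

lex-≤₁ : ∀ {a₁ a₂ b₁ b₂} → (a₁ , a₂) ≤ₗₑₓ (b₁ , b₂) → a₁ ℤ.≤ b₁
lex-≤₁ (inj₁ (a₁≤b₁ , _)) = a₁≤b₁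
lex-≤₁ (inj₂ (a₁≡b₁ , _)) = ℤP.≤-reflexive a₁≡b₁

lex-≤₂ : ∀ {a₁ a₂ b₁ b₂} → (a₁ , a₂) ≤ₗₑₓ (b₁ , b₂) → a₁ ≡ b₁ → a₂ ℤ.≤ b₂
lex-≤₂ (inj₁ (_ , a₁≢b₁)) a₁≡b₁ = ⊥-elim (a₁≢b₁ a₁≡b₁)
lex-≤₂ (inj₂ (_ , a₂≤b₂)) _     = a₂≤b₂

-- Vertices of P(f)

module _ {n d : ℕ} (f : BoolFun n d) where

  InP-segment : ∀ {u v y s} → M₁ f u → M₁ f v → 0ℚ ℚ.≤ s → s ℚ.≤ 1ℚ →
                y ≈ᵥ (λ j → (1ℚ ℚ.- s) ℚ.* emb u j ℚ.+ s ℚ.* emb v j) → InP f y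
  InP-segment {u} {v} {y} {s} u∈M₁ v∈M₁ 0≤s s≤1 y≈ =
    2 , point , weight , point∈M₁ , weight-nonNeg , sum≡1 s , λ j → trans (y≈ j) (pad ((1ℚ ℚ.- s) ℚ.* emb u j) s (emb v j))
    where
    point : Fin 2 → E n d
    point zero    = u
    point (suc _) = v
    weight : Fin 2 → ℚ
    weight zero    = 1ℚ ℚ.- s
    weight (suc _) = s
    point∈M₁ : ∀ i → M₁ f (point i)
    point∈M₁ zero       = u∈M₁
    point∈M₁ (suc zero) = v∈M₁
    weight-nonNeg : ∀ i → 0ℚ ℚ.≤ weight i
    weight-nonNeg zero       = p≤q⇒0≤q-p s≤1
    weight-nonNeg (suc zero) = 0≤s
    open +-*-Solver
    sum≡1 : ∀ s → (1ℚ ℚ.- s) ℚ.+ (s ℚ.+ 0ℚ) ≡ 1ℚ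
    sum≡1 = solve 1 (λ s → (con 1ℚ :- s) :+ (s :+ con 0ℚ) := con 1ℚ) refl
    pad : ∀ a s b → a ℚ.+ s ℚ.* b ≡ a ℚ.+ (s ℚ.* b ℚ.+ 0ℚ)
    pad = solve 3 (λ a s b → a :+ s :* b := a :+ (s :* b :+ con 0ℚ)) refl

  InP-point : ∀ {x y} → M₁ f x → y ≈ᵥ emb x → InP f y
  InP-point {x} x∈M₁ y≈x = InP-segment x∈M₁ x∈M₁ ℚP.≤-refl (ℚP.nonNegative⁻¹ 1ℚ)
                                       (λ j → trans (y≈x j) (stay (emb x j)))
    where
    stay : ∀ a → a ≡ (1ℚ ℚ.- 0ℚ) ℚ.* a ℚ.+ 0ℚ ℚ.* a
    stay = solve 1 (λ a → a := (con 1ℚ :- con 0ℚ) :* a :+ con 0ℚ :* a) refl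
      where open +-*-Solver

  InP-nonempty : ∀ {y} → InP f y → ∃ (M₁ f)
  InP-nonempty (suc m , p , _ , p∈M₁ , _) = p zero , p∈M₁ zero

  module _ (disjoint : DisjointP-M0 f) where

    InP⇒M₁ : ∀ x → InP f (emb x) → M₁ f x
    InP⇒M₁ x x∈P with f x in fx≡
    ... | zero     = ⊥-elim (disjoint x fx≡ x∈P)
    ... | suc zero = refl

    M₁-resp : ∀ {x y} → (∀ j → x j ≡ y j) → M₁ f x → M₁ f y
    M₁-resp {x} {y} x≗y x∈M₁ = InP⇒M₁ y (InP-point x∈M₁ (emb-cong (sym ∘ x≗y)))

    -- The lexicographic minimiser is cut out by two successive faces.
    lex-key : (Fin d → ℤ) → E n d → ℤ × ℤ
    lex-key c z = c ∙ grid z , pow (+ n) ∙ grid z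

    lexmin-isVertex : ∀ c {w} → M₁ f w → (∀ z → M₁ f z → lex-key c w ≤ₗₑₓ lex-key c z) → IsVertex f (emb w)
    lexmin-isVertex c {w} w∈M₁ w-min = InP-point w∈M₁ (λ _ → refl) , extreme
      where
      T = pow (+ n)
      cℚ = toℚ ∘ c
      Tℚ = toℚ ∘ T

      min₁ : ∀ z → M₁ f z → ⟨ cℚ , emb w ⟩ ℚ.≤ ⟨ cℚ , emb z ⟩
      min₁ z z∈M₁ = subst₂ ℚ._≤_ (sym (⟨⟩-grid c w)) (sym (⟨⟩-grid c z)) (toℚ-mono-≤ (lex-≤₁ (w-min z z∈M₁)))

      min₂ : ∀ z → Face (M₁ f) cℚ ⟨ cℚ , emb w ⟩ z → ⟨ Tℚ , emb w ⟩ ℚ.≤ ⟨ Tℚ , emb z ⟩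
      min₂ z (z∈M₁ , tie) = subst₂ ℚ._≤_ (sym (⟨⟩-grid T w)) (sym (⟨⟩-grid T z))
        (toℚ-mono-≤ (lex-≤₂ (w-min z z∈M₁) (toℚ-injective (trans (sym (⟨⟩-grid c w)) (trans (sym tie) (⟨⟩-grid c z))))))

      unique : ∀ z → Face (Face (M₁ f) cℚ ⟨ cℚ , emb w ⟩) Tℚ ⟨ Tℚ , emb w ⟩ z → emb z ≈ᵥ emb w
      unique z (_ , tie) = emb-cong
        (pow-∙-grid-injective z w (toℚ-injective (trans (sym (⟨⟩-grid T z)) (trans tie (⟨⟩-grid T w)))))

      extreme : ∀ a b t → InP f a → InP f b → 0ℚ ℚ.< t → t ℚ.< 1ℚ →
                (∀ j → emb w j ≡ (1ℚ ℚ.- t) ℚ.* a j ℚ.+ t ℚ.* b j) → a ≈ᵥ b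
      extreme a b t a∈P b∈P =
        lexmin⇒extreme {S = M₁ f} {w = w} cℚ Tℚ min₁ min₂ unique {t = t} (InP⇒Hull f a∈P) (InP⇒Hull f b∈P)

    supporting-vertex : ∀ (c : Fin d → ℤ) {x₀} → M₁ f x₀ →
                        ∃ λ w → M₁ f w × IsVertex f (emb w) × ∀ z → M₁ f z → c ∙ grid w ℤ.≤ c ∙ grid z
    supporting-vertex c x₀∈M₁ =
      let w , w∈M₁ , w-min = grid-argmin Lex (λ z → f z Fin.≟ suc zero) (lex-key c) M₁-resp key-resp x₀∈M₁
      in  w , w∈M₁ , lexmin-isVertex c w∈M₁ w-min , λ z z∈M₁ → lex-≤₁ (w-min z z∈M₁)
      where
      key-resp : ∀ {x y} → (∀ j → x j ≡ y j) → lex-key c x ≡ lex-key c y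
      key-resp x≗y = cong₂ _,_ (∙-grid-cong c x≗y) (∙-grid-cong (pow (+ n)) x≗y)

-- Descriptions by two inequalities

IsSlab : ∀ {n d} → BoolFun n d → Set
IsSlab {n} {d} f = Σ (Fin d → ℤ) λ a → Σ ℤ λ s → Σ ℤ λ r →
                   ∀ x → M₁ f x ⇔ (s ℤ.≤ a ∙ grid x × a ∙ grid x ℤ.≤ r)

slab⇒InT : ∀ {n d} (f : BoolFun n d) → IsSlab f → ∀ k → 2 ℕ.≤ k → InT d n k f
slab⇒InT {n} {d} f (a , s , r , M₁⇔) (suc (suc k)) (ℕ.s≤s (ℕ.s≤s _)) = rows , λ x → mk⇔ (to x) (from x)
  where
  rows : Fin (suc (suc k)) → Fin (suc d) → ℚ
  rows zero          zero    = toℚ r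
  rows zero          (suc j) = toℚ (a j)
  rows (suc zero)    zero    = toℚ (ℤ.- s)
  rows (suc zero)    (suc j) = toℚ (ℤ.- a j)
  rows (suc (suc _)) _       = 0ℚ

  lhs : Fin (suc (suc k)) → E n d → ℚ
  lhs i x = sumFin d (λ j → rows i (suc j) ℚ.* emb x j)

  lhs₀ : ∀ x → lhs zero x ≡ toℚ (a ∙ grid x)
  lhs₀ = ⟨⟩-grid a

  lhs₁ : ∀ x → lhs (suc zero) x ≡ toℚ (ℤ.- (a ∙ grid x))
  lhs₁ x = trans (⟨⟩-grid (λ j → ℤ.- a j) x) (cong toℚ (∙-negˡ a (grid x)))

  to : ∀ x → M₁ f x → ∀ i → lhs i x ℚ.≤ rows i zero
  to x x∈M₁ zero          = subst (ℚ._≤ toℚ r) (sym (lhs₀ x)) (toℚ-mono-≤ (proj₂ (Equivalence.to (M₁⇔ x) x∈M₁)))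
  to x x∈M₁ (suc zero)    = subst (ℚ._≤ toℚ (ℤ.- s)) (sym (lhs₁ x))
                                  (toℚ-mono-≤ (ℤP.neg-mono-≤ (proj₁ (Equivalence.to (M₁⇔ x) x∈M₁))))
  to x x∈M₁ (suc (suc _)) = ℚP.≤-reflexive (trans (sumFin-cong d (λ j → ℚP.*-zeroˡ (emb x j))) (sumFin-zero d))

  from : ∀ x → (∀ i → lhs i x ℚ.≤ rows i zero) → M₁ f x
  from x lhs≤ = Equivalence.from (M₁⇔ x)
    ( ℤP.neg-cancel-≤ (toℚ-cancel-≤ (subst (ℚ._≤ toℚ (ℤ.- s)) (lhs₁ x) (lhs≤ (suc zero))))
    , toℚ-cancel-≤ (subst (ℚ._≤ toℚ r) (lhs₀ x) (lhs≤ zero)) )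

module _ {n d : ℕ} (f : BoolFun n d) (disjoint : DisjointP-M0 f) where

  point-slab : ∀ {u} → M₁ f u → (∀ x → M₁ f x → ∀ j → x j ≡ u j) → IsSlab f
  point-slab {u} u∈M₁ M₁⊆u = T , T ∙ grid u , T ∙ grid u , λ x → mk⇔ (on-slab x) (off-slab x)
    where
    T = pow (+ n)
    on-slab : ∀ x → M₁ f x → T ∙ grid u ℤ.≤ T ∙ grid x × T ∙ grid x ℤ.≤ T ∙ grid u
    on-slab x x∈M₁ = ℤP.≤-reflexive (sym Tx≡Tu) , ℤP.≤-reflexive Tx≡Tu
      where Tx≡Tu = ∙-grid-cong T (M₁⊆u x x∈M₁)
    off-slab : ∀ x → T ∙ grid u ℤ.≤ T ∙ grid x × T ∙ grid x ℤ.≤ T ∙ grid u → M₁ f x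
    off-slab x (lower , upper) =
      M₁-resp f disjoint (λ j → sym (pow-∙-grid-injective x u (ℤP.≤-antisym upper lower) j)) u∈M₁

  module _ {u v : E n d} (u∈M₁ : M₁ f u) (v∈M₁ : M₁ f v) (i : Fin d) (uᵢ<vᵢ : toℕ (u i) ℕ.< toℕ (v i))
           (supported : ∀ c x → M₁ f x → c ∙ grid u ℤ.≤ c ∙ grid x ⊎ c ∙ grid v ℤ.≤ c ∙ grid x) where

    private
      U = grid u
      V = grid v

    min≤∙ : ∀ c x → M₁ f x → c ∙ U ℤ.⊓ c ∙ V ℤ.≤ c ∙ grid x
    min≤∙ c x x∈M₁ with supported c x x∈M₁
    ... | inj₁ cU≤cX = ℤP.≤-trans (ℤP.i⊓j≤i (c ∙ U) (c ∙ V)) cU≤cX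
    ... | inj₂ cV≤cX = ℤP.≤-trans (ℤP.i⊓j≤j (c ∙ U) (c ∙ V)) cV≤cX

    ∙≤max : ∀ c x → M₁ f x → c ∙ grid x ℤ.≤ c ∙ U ℤ.⊔ c ∙ V
    ∙≤max c x x∈M₁ = ℤP.neg-cancel-≤ (begin
      ℤ.- (c ∙ U ℤ.⊔ c ∙ V)               ≡⟨ ℤP.neg-distrib-⊔-⊓ (c ∙ U) (c ∙ V) ⟩
      ℤ.- (c ∙ U) ℤ.⊓ ℤ.- (c ∙ V)         ≡⟨ cong₂ ℤ._⊓_ (∙-negˡ c U) (∙-negˡ c V) ⟨
      -c ∙ U ℤ.⊓ -c ∙ V                   ≤⟨ min≤∙ -c x x∈M₁ ⟩
      -c ∙ grid x                         ≡⟨ ∙-negˡ c (grid x) ⟩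
      ℤ.- (c ∙ grid x)                    ∎)
      where
      open ℤP.≤-Reasoning
      -c = λ j → ℤ.- c j

    M₁-∙-constant : ∀ c → c ∙ U ≡ c ∙ V → ∀ x → M₁ f x → c ∙ grid x ≡ c ∙ U
    M₁-∙-constant c cU≡cV x x∈M₁ = ℤP.≤-antisym
      (subst (c ∙ grid x ℤ.≤_) (trans (cong (c ∙ U ℤ.⊔_) (sym cU≡cV)) (ℤP.⊔-idem (c ∙ U))) (∙≤max c x x∈M₁))
      (subst (ℤ._≤ c ∙ grid x) (trans (cong (c ∙ U ℤ.⊓_) (sym cU≡cV)) (ℤP.⊓-idem (c ∙ U))) (min≤∙ c x x∈M₁))

    M₁-between : ∀ x → M₁ f x → U i ℤ.≤ grid x i × grid x i ℤ.≤ V i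
    M₁-between x x∈M₁ =
      subst₂ ℤ._≤_ (trans (cong₂ ℤ._⊓_ (δ-∙ i U) (δ-∙ i V)) (ℤP.i≤j⇒i⊓j≡i Uᵢ≤Vᵢ)) (δ-∙ i (grid x))
                   (min≤∙ (δ i) x x∈M₁) ,
      subst₂ ℤ._≤_ (δ-∙ i (grid x)) (trans (cong₂ ℤ._⊔_ (δ-∙ i U) (δ-∙ i V)) (ℤP.i≤j⇒i⊔j≡j Uᵢ≤Vᵢ))
                   (∙≤max (δ i) x x∈M₁)
      where
      Uᵢ≤Vᵢ : U i ℤ.≤ V i
      Uᵢ≤Vᵢ = ℤ.+≤+ (ℕP.<⇒≤ uᵢ<vᵢ)

    private
      e : Fin d → ℤ
      e j = V j ℤ.- U j

      N : ℕ
      N = n ℕ.* n ℕ.+ n ℕ.* n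

    defect-coeffs : Fin d → Fin d → ℤ
    defect-coeffs j k = e i ℤ.* δ j k ℤ.+ ℤ.- e j ℤ.* δ i k

    -- defect x j = 0 says that x - u and v - u are parallel in the (i, j)-plane.
    defect : E n d → Fin d → ℤ
    defect x j = defect-coeffs j ∙ grid x ℤ.- defect-coeffs j ∙ U

    defect-formula : ∀ x j → defect x j ≡ e i ℤ.* (grid x j ℤ.- U j) ℤ.- e j ℤ.* (grid x i ℤ.- U i)
    defect-formula x j = trans (cong₂ ℤ._-_ (coeffs-∙ (grid x)) (coeffs-∙ U)) (regroup (e i) (e j) _ _ _ _)
      where
      coeffs-∙ : ∀ X → defect-coeffs j ∙ X ≡ e i ℤ.* X j ℤ.+ ℤ.- e j ℤ.* X i
      coeffs-∙ X = trans (∙-linearˡ (e i) (ℤ.- e j) (δ j) (δ i) X)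
                         (cong₂ (λ p q → e i ℤ.* p ℤ.+ ℤ.- e j ℤ.* q) (δ-∙ j X) (δ-∙ i X))
      regroup : ∀ a b xⱼ xᵢ uⱼ uᵢ → (a ℤ.* xⱼ ℤ.+ ℤ.- b ℤ.* xᵢ) ℤ.- (a ℤ.* uⱼ ℤ.+ ℤ.- b ℤ.* uᵢ) ≡
                                    a ℤ.* (xⱼ ℤ.- uⱼ) ℤ.- b ℤ.* (xᵢ ℤ.- uᵢ)
      regroup = solve-∀

    defect-vanishes : ∀ x → M₁ f x → ∀ j → defect x j ≡ ℤ.0ℤ
    defect-vanishes x x∈M₁ j = ℤP.i≡j⇒i-j≡0 (M₁-∙-constant (defect-coeffs j) cU≡cV x x∈M₁)
      where
      cU≡cV : defect-coeffs j ∙ U ≡ defect-coeffs j ∙ V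
      cU≡cV = sym (ℤP.i-j≡0⇒i≡j _ _ (trans (defect-formula v j) (antisymmetric (e i) (e j))))
        where
        antisymmetric : ∀ a b → a ℤ.* b ℤ.- b ℤ.* a ≡ ℤ.0ℤ
        antisymmetric = solve-∀

    ∣defect∣<N : ∀ x j → ℤ.∣ defect x j ∣ ℕ.< N
    ∣defect∣<N x j = begin-strict
      ℤ.∣ defect x j ∣
        ≡⟨ cong ℤ.∣_∣ (defect-formula x j) ⟩
      ℤ.∣ e i ℤ.* (grid x j ℤ.- U j) ℤ.- e j ℤ.* (grid x i ℤ.- U i) ∣
        ≤⟨ ℤP.∣i-j∣≤∣i∣+∣j∣ (e i ℤ.* (grid x j ℤ.- U j)) (e j ℤ.* (grid x i ℤ.- U i)) ⟩
      ℤ.∣ e i ℤ.* (grid x j ℤ.- U j) ∣ ℕ.+ ℤ.∣ e j ℤ.* (grid x i ℤ.- U i) ∣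
        ≡⟨ cong₂ ℕ._+_ (ℤP.abs-* (e i) _) (ℤP.abs-* (e j) _) ⟩
      ℤ.∣ e i ∣ ℕ.* ℤ.∣ grid x j ℤ.- U j ∣ ℕ.+ ℤ.∣ e j ∣ ℕ.* ℤ.∣ grid x i ℤ.- U i ∣
        <⟨ ℕP.+-mono-< (ℕP.*-mono-< (∣grid-grid∣<n v u i) (∣grid-grid∣<n x u j))
                       (ℕP.*-mono-< (∣grid-grid∣<n v u j) (∣grid-grid∣<n x u i)) ⟩
      N ∎
      where open ℕP.≤-Reasoning

    private
      P = pow (+ N)

    D : Fin d → ℤ
    D k = e i ℤ.* P k ℤ.+ ℤ.- (P ∙ e) ℤ.* δ i k

    D-∙-difference : ∀ x → D ∙ grid x ℤ.- D ∙ U ≡ P ∙ defect x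
    D-∙-difference x = begin
      D ∙ X ℤ.- D ∙ U
        ≡⟨ cong₂ ℤ._-_ (D-∙ X) (D-∙ U) ⟩
      (e i ℤ.* (P ∙ X) ℤ.+ ℤ.- (P ∙ e) ℤ.* X i) ℤ.- (e i ℤ.* (P ∙ U) ℤ.+ ℤ.- (P ∙ e) ℤ.* U i)
        ≡⟨ regroup (e i) (P ∙ X) (P ∙ U) (P ∙ e) (X i) (U i) ⟩
      e i ℤ.* (P ∙ X ℤ.- P ∙ U) ℤ.+ ℤ.- (X i ℤ.- U i) ℤ.* (P ∙ e)
        ≡⟨ cong (λ z → e i ℤ.* z ℤ.+ ℤ.- (X i ℤ.- U i) ℤ.* (P ∙ e)) (∙-−ʳ P X U) ⟨
      e i ℤ.* (P ∙ (λ j → X j ℤ.- U j)) ℤ.+ ℤ.- (X i ℤ.- U i) ℤ.* (P ∙ e)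
        ≡⟨ ∙-linearʳ (e i) (ℤ.- (X i ℤ.- U i)) P (λ j → X j ℤ.- U j) e ⟨
      P ∙ (λ j → e i ℤ.* (X j ℤ.- U j) ℤ.+ ℤ.- (X i ℤ.- U i) ℤ.* e j)
        ≡⟨ ∙-congʳ P (λ j → trans (reorder (e i) (e j) (X j ℤ.- U j) (X i ℤ.- U i)) (sym (defect-formula x j))) ⟩
      P ∙ defect x ∎
      where
      open ≡-Reasoning
      X = grid x
      D-∙ : ∀ Y → D ∙ Y ≡ e i ℤ.* (P ∙ Y) ℤ.+ ℤ.- (P ∙ e) ℤ.* Y i
      D-∙ Y = trans (∙-linearˡ (e i) (ℤ.- (P ∙ e)) P (δ i) Y)
                    (cong (λ z → e i ℤ.* (P ∙ Y) ℤ.+ ℤ.- (P ∙ e) ℤ.* z) (δ-∙ i Y))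
      regroup : ∀ a px pu pe xᵢ uᵢ → (a ℤ.* px ℤ.+ ℤ.- pe ℤ.* xᵢ) ℤ.- (a ℤ.* pu ℤ.+ ℤ.- pe ℤ.* uᵢ) ≡
                                     a ℤ.* (px ℤ.- pu) ℤ.+ ℤ.- (xᵢ ℤ.- uᵢ) ℤ.* pe
      regroup = solve-∀
      reorder : ∀ a b p q → a ℤ.* p ℤ.+ ℤ.- q ℤ.* b ≡ a ℤ.* p ℤ.- b ℤ.* q
      reorder = solve-∀

    private
      Δ : E n d → ℤ
      Δ x = D ∙ grid x ℤ.- D ∙ U

      base : ℤ
      base = + n ℤ.* (D ∙ U)

    slab-coeffs : Fin d → ℤ
    slab-coeffs k = + n ℤ.* D k ℤ.+ ℤ.1ℤ ℤ.* δ i k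

    slab-∙ : ∀ x → slab-coeffs ∙ grid x ≡ base ℤ.+ (+ n ℤ.* Δ x ℤ.+ grid x i)
    slab-∙ x = begin
      slab-coeffs ∙ grid x                             ≡⟨ ∙-linearˡ (+ n) ℤ.1ℤ D (δ i) (grid x) ⟩
      + n ℤ.* (D ∙ grid x) ℤ.+ ℤ.1ℤ ℤ.* (δ i ∙ grid x)  ≡⟨ cong (λ z → + n ℤ.* (D ∙ grid x) ℤ.+ ℤ.1ℤ ℤ.* z)
                                                              (δ-∙ i (grid x)) ⟩
      + n ℤ.* (D ∙ grid x) ℤ.+ ℤ.1ℤ ℤ.* grid x i        ≡⟨ regroup (+ n) (D ∙ grid x) (D ∙ U) (grid x i) ⟩
      base ℤ.+ (+ n ℤ.* Δ x ℤ.+ grid x i)              ∎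
      where
      open ≡-Reasoning
      regroup : ∀ k a b c → k ℤ.* a ℤ.+ ℤ.1ℤ ℤ.* c ≡ k ℤ.* b ℤ.+ (k ℤ.* (a ℤ.- b) ℤ.+ c)
      regroup = solve-∀

    digit-shift : ∀ x → Δ x ≡ ℤ.0ℤ → + n ℤ.* Δ x ℤ.+ grid x i ≡ grid x i
    digit-shift x Δ≡0 = trans (cong (λ z → + n ℤ.* z ℤ.+ grid x i) Δ≡0)
                              (trans (cong (ℤ._+ grid x i) (ℤP.*-zeroʳ (+ n))) (ℤP.+-identityˡ (grid x i)))

    defect-free⇒parallel : ∀ x → (∀ j → defect x j ≡ ℤ.0ℤ) → ∀ j →
                           (emb v i ℚ.- emb u i) ℚ.* (emb x j ℚ.- emb u j) ≡ (emb v j ℚ.- emb u j) ℚ.* (emb x i ℚ.- emb u i)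
    defect-free⇒parallel x defect≡0 j = begin
      (emb v i ℚ.- emb u i) ℚ.* (emb x j ℚ.- emb u j)   ≡⟨ cong₂ ℚ._*_ (toℚ-- (V i) (U i)) (toℚ-- (grid x j) (U j)) ⟨
      toℚ (e i) ℚ.* toℚ (grid x j ℤ.- U j)             ≡⟨ toℚ-* (e i) _ ⟨
      toℚ (e i ℤ.* (grid x j ℤ.- U j))                 ≡⟨ cong toℚ (ℤP.i-j≡0⇒i≡j (e i ℤ.* (grid x j ℤ.- U j)) _
                                                            (trans (sym (defect-formula x j)) (defect≡0 j))) ⟩
      toℚ (e j ℤ.* (grid x i ℤ.- U i))                 ≡⟨ toℚ-* (e j) _ ⟩
      toℚ (e j) ℚ.* toℚ (grid x i ℤ.- U i)             ≡⟨ cong₂ ℚ._*_ (toℚ-- (V j) (U j)) (toℚ-- (grid x i) (U i)) ⟩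
      (emb v j ℚ.- emb u j) ℚ.* (emb x i ℚ.- emb u i)   ∎
      where open ≡-Reasoning

    segment-slab : IsSlab f
    segment-slab = slab-coeffs , base ℤ.+ U i , base ℤ.+ V i , λ x → mk⇔ (on-slab x) (off-slab x)
      where
      on-slab : ∀ x → M₁ f x → base ℤ.+ U i ℤ.≤ slab-coeffs ∙ grid x × slab-coeffs ∙ grid x ℤ.≤ base ℤ.+ V i
      on-slab x x∈M₁ =
        subst (base ℤ.+ U i ℤ.≤_) (sym (slab-∙ x)) (ℤP.+-monoʳ-≤ base (subst (U i ℤ.≤_) (sym shift) Uᵢ≤Xᵢ)) ,
        subst (ℤ._≤ base ℤ.+ V i) (sym (slab-∙ x)) (ℤP.+-monoʳ-≤ base (subst (ℤ._≤ V i) (sym shift) Xᵢ≤Vᵢ))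
        where
        Uᵢ≤Xᵢ = proj₁ (M₁-between x x∈M₁)
        Xᵢ≤Vᵢ = proj₂ (M₁-between x x∈M₁)
        shift = digit-shift x (trans (D-∙-difference x) (trans (∙-congʳ P (defect-vanishes x x∈M₁)) (∙-zeroʳ {d} P)))

      off-slab : ∀ x → base ℤ.+ U i ℤ.≤ slab-coeffs ∙ grid x × slab-coeffs ∙ grid x ℤ.≤ base ℤ.+ V i → M₁ f x
      off-slab x (lower , upper) = InP⇒M₁ f disjoint x (InP-segment f u∈M₁ v∈M₁ 0≤s s≤1 x≈)
        where
        lo = +-cancelˡ-≤ base (subst (base ℤ.+ U i ℤ.≤_) (slab-∙ x) lower)
        hi = +-cancelˡ-≤ base (subst (ℤ._≤ base ℤ.+ V i) (slab-∙ x) upper)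
        Δ≡0 = window-zero n (Δ x) (FinP.toℕ<n (x i)) (FinP.toℕ<n (v i)) lo hi
        defect≡0 = pow-digits-zero N (defect x) (∣defect∣<N x) (trans (sym (D-∙-difference x)) Δ≡0)
        shift = digit-shift x Δ≡0
        segment = collinear⇒segment (emb u) (emb v) (emb x) i (toℚ-mono-< (ℤ.+<+ uᵢ<vᵢ))
                    (toℚ-mono-≤ (subst (U i ℤ.≤_) shift lo)) (toℚ-mono-≤ (subst (ℤ._≤ V i) shift hi))
                    (defect-free⇒parallel x defect≡0)
        0≤s = proj₁ (proj₂ segment)
        s≤1 = proj₁ (proj₂ (proj₂ segment))
        x≈ = proj₂ (proj₂ (proj₂ segment))

module _ {n d : ℕ} (f : BoolFun n d) (disjoint : DisjointP-M0 f) (few-vertices : OneOrTwoVertices f) where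

  private
    T -T : Fin d → ℤ
    T = pow (+ n)
    -T = λ j → ℤ.- T j

  two-vertex-support : ∀ {u v} → IsVertex f (emb u) → IsVertex f (emb v) → ¬ (∀ j → u j ≡ v j) →
                       ∀ c x → M₁ f x → c ∙ grid u ℤ.≤ c ∙ grid x ⊎ c ∙ grid v ℤ.≤ c ∙ grid x
  two-vertex-support {u} {v} u-vertex v-vertex u≉v c x x∈M₁ =
    cases (proj₂ few-vertices (emb u) (emb v) (emb w) u-vertex v-vertex w-vertex)
    where
    supporting = supporting-vertex f disjoint c x∈M₁
    w = proj₁ supporting
    w-vertex = proj₁ (proj₂ (proj₂ supporting))
    cw≤cx : c ∙ grid w ℤ.≤ c ∙ grid x
    cw≤cx = proj₂ (proj₂ (proj₂ supporting)) x x∈M₁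
    cases : emb u ≈ᵥ emb v ⊎ (emb u ≈ᵥ emb w ⊎ emb v ≈ᵥ emb w) →
            c ∙ grid u ℤ.≤ c ∙ grid x ⊎ c ∙ grid v ℤ.≤ c ∙ grid x
    cases (inj₁ u≈v)        = ⊥-elim (u≉v (emb-injective u≈v))
    cases (inj₂ (inj₁ u≈w)) = inj₁ (subst (ℤ._≤ c ∙ grid x) (∙-grid-cong c (sym ∘ emb-injective u≈w)) cw≤cx)
    cases (inj₂ (inj₂ v≈w)) = inj₂ (subst (ℤ._≤ c ∙ grid x) (∙-grid-cong c (sym ∘ emb-injective v≈w)) cw≤cx)

  distinct-vertices-slab : ∀ {u v} → M₁ f u → M₁ f v → IsVertex f (emb u) → IsVertex f (emb v) →
                           ¬ (∀ j → u j ≡ v j) → IsSlab f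
  distinct-vertices-slab {u} {v} u∈M₁ v∈M₁ u-vertex v-vertex u≉v =
    let i , uᵢ≢vᵢ = FinP.¬∀⟶∃¬ d _ (λ j → u j Fin.≟ v j) u≉v
    in  by-order i uᵢ≢vᵢ (ℕP.<-cmp (toℕ (u i)) (toℕ (v i)))
    where
    by-order : ∀ i → ¬ u i ≡ v i → Tri (toℕ (u i) ℕ.< toℕ (v i)) (toℕ (u i) ≡ toℕ (v i)) (toℕ (v i) ℕ.< toℕ (u i)) →
               IsSlab f
    by-order i _     (tri< uᵢ<vᵢ _ _) = segment-slab f disjoint u∈M₁ v∈M₁ i uᵢ<vᵢ (two-vertex-support u-vertex v-vertex u≉v)
    by-order i uᵢ≢vᵢ (tri≈ _ uᵢ≡vᵢ _) = ⊥-elim (uᵢ≢vᵢ (FinP.toℕ-injective uᵢ≡vᵢ))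
    by-order i _     (tri> _ _ vᵢ<uᵢ) = segment-slab f disjoint v∈M₁ u∈M₁ i vᵢ<uᵢ
                                          (two-vertex-support v-vertex u-vertex (λ v≗u → u≉v (sym ∘ v≗u)))

  extremes-slab : ∀ {u v} → M₁ f u → M₁ f v → IsVertex f (emb u) → IsVertex f (emb v) →
                  (∀ x → M₁ f x → T ∙ grid u ℤ.≤ T ∙ grid x) → (∀ x → M₁ f x → -T ∙ grid v ℤ.≤ -T ∙ grid x) →
                  IsSlab f
  extremes-slab {u} {v} u∈M₁ v∈M₁ u-vertex v-vertex u-min v-min = by-coincidence (FinP.all? (λ j → u j Fin.≟ v j))
    where
    by-coincidence : Dec (∀ j → u j ≡ v j) → IsSlab f
    by-coincidence (no u≉v)  = distinct-vertices-slab u∈M₁ v∈M₁ u-vertex v-vertex u≉v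
    by-coincidence (yes u≗v) = point-slab f disjoint u∈M₁ λ x x∈M₁ →
                                 pow-∙-grid-injective x u (ℤP.≤-antisym (T-max x x∈M₁) (u-min x x∈M₁))
      where
      T-max : ∀ x → M₁ f x → T ∙ grid x ℤ.≤ T ∙ grid u
      T-max x x∈M₁ = ℤP.neg-cancel-≤ (subst₂ ℤ._≤_ (trans (∙-negˡ T (grid v)) (cong ℤ.-_ (∙-grid-cong T (sym ∘ u≗v))))
                                                  (∙-negˡ T (grid x)) (v-min x x∈M₁))

  M₁-isSlab : IsSlab f
  M₁-isSlab =
    let x₀ , x₀∈M₁                   = InP-nonempty f (proj₁ (proj₂ (proj₁ few-vertices)))
        u , u∈M₁ , u-vertex , u-min = supporting-vertex f disjoint T x₀∈M₁
        v , v∈M₁ , v-vertex , v-min = supporting-vertex f disjoint -T x₀∈M₁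
    in  extremes-slab u∈M₁ v∈M₁ u-vertex v-vertex u-min v-min

lemma1 : (n d : ℕ) → 2 ≤ n → 1 ≤ d → (f : BoolFun n d) →
    OneOrTwoVertices f → DisjointP-M0 f →
    (k : ℕ) → 2 ≤ k → InT d n k f
lemma1 n d _ _ f few-vertices disjoint = slab⇒InT f (M₁-isSlab f disjoint few-vertices)
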